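{- Let $p$ be a positive integer. If $F$ is a forest whose maximum induced matching has size at most $p$, then every reduced forest of $F$ has at most $6p$ vertices.
   Context: A reduced forest of a forest $F$ is an induced subforest of $F$ obtained as follows: (i) remove all isolated vertices of $F$; (ii) for each connected component of $F$ with exactly $2$ vertices, remove one (either) of its two vertices; (iii) for each connected component of $F$ with at least $3$ vertices, remove all leaves (degree-$1$ vertices) of that component. An induced matching is a matching $\{a_1b_1,\dots,a_kb_k\}$ such that the subgraph induced by $\{a_1,b_1,\dots,a_k,b_k\}$ has no other edges. -}

module Defs where

open import Data.Nat using (ℕ; zero; suc; _+_; _≤_)
open import Data.Fin using (Fin; zero; suc; inject₁; fromℕ)
open import Data.Bool using (Bool; true; false; T; if_then_else_)
open import Data.List using (List; map; allFin)
open import Data.Nat.ListAction using (sum)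
open import Data.Product using (Σ; ∃; _×_; _,_)
open import Data.Sum using (_⊎_)
open import Relation.Nullary using (¬_)
open import Relation.Binary.PropositionalEquality using (_≡_; _≢_)
open import Function.Definitions using (Injective)

record Graph (n : ℕ) : Set where
  field
    adj    : Fin n → Fin n → Bool
    sym    : ∀ u v → adj u v ≡ adj v u
    irrefl : ∀ v → adj v v ≡ false
open Graph public

module _ {n : ℕ} (G : Graph n) where

  Adj : Fin n → Fin n → Set
  Adj u v = adj G u v ≡ true

  deg : Fin n → ℕ
  deg v = sum (map (λ w → if adj G v w then 1 else 0) (allFin n))

  record Cycle : Set where
    field
      m     : ℕ
      c     : Fin (suc (suc (suc m))) → Fin n
      inj   : Injective _≡_ _≡_ c
      edges : ∀ (i : Fin (suc (suc m))) → Adj (c (inject₁ i)) (c (suc i))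
      close : Adj (c (fromℕ (suc (suc m)))) (c zero)

  IsForest : Set
  IsForest = ¬ Cycle

  data Reach : Fin n → Fin n → Set where
    here : ∀ {v} → Reach v v
    step : ∀ {u w v} → Adj u w → Reach w v → Reach u v

  TwoComponent : Fin n → Fin n → Set
  TwoComponent v u = u ≢ v × Reach v u × (∀ w → Reach v w → w ≡ v ⊎ w ≡ u)

  BigComponent : Fin n → Set
  BigComponent v = ∃ λ x → ∃ λ y → ∃ λ z →
    Reach v x × Reach v y × Reach v z × x ≢ y × x ≢ z × y ≢ z

  -- S (a vertex subset) is a reduced forest of G: the vertex set obtained by
  -- (i) removing isolated vertices, (ii) removing exactly one vertex of each
  -- 2-vertex component, (iii) removing the leaves of each component with
  -- at least 3 vertices.  (The reduced forest is the subgraph induced by S.)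
  record IsReducedForest (S : Fin n → Bool) : Set where
    field
      isolated : ∀ v → deg v ≡ 0 → S v ≡ false
      two      : ∀ v u → TwoComponent v u → S v ≢ S u
      big-leaf : ∀ v → BigComponent v → deg v ≡ 1 → S v ≡ false
      big-keep : ∀ v → BigComponent v → deg v ≢ 1 → S v ≡ true

  record InducedMatching (k : ℕ) : Set where
    field
      a b     : Fin k → Fin n
      edge    : ∀ i → Adj (a i) (b i)
      disjoint : ∀ i j → i ≢ j →
        a i ≢ a j × a i ≢ b j × b i ≢ a j × b i ≢ b j
      induced : ∀ i j → i ≢ j →
        ¬ Adj (a i) (a j) × ¬ Adj (a i) (b j) × ¬ Adj (b i) (a j) × ¬ Adj (b i) (b j)

  MaxIndMatchingAtMost : ℕ → Set
  MaxIndMatchingAtMost p = ∀ k → InducedMatching k → k ≤ p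

size : ∀ {n} → (Fin n → Bool) → ℕ
size {n} S = sum (map (λ v → if S v then 1 else 0) (allFin n))

-- Root every component of the forest F and write depth for the
-- distance to the root.  Every vertex v of a reduced forest S is charged to a
-- parent edge (t, b), where t is the parent of b:
--   * if v has a child c, the edge (v, c);
--   * otherwise v is not isolated, so its only neighbour u is its parent; then
--     v is a leaf, so its component is {v, u} and u is the vertex of that
--     component left out of S; the edge is (u, v).
-- The tops t of the charged edges are pairwise distinct.  Two parent edges
-- whose tops are distinct and have depths congruent modulo 3 are disjoint and
-- non-adjacent, so each of the three residue classes of charged edges is an
-- induced matching and has at most p elements.

module Submission where

open import Defs hiding (sym)
open import Data.Nat using (ℕ; zero; suc; _+_; _*_; _≤_; _<_; z≤n; s≤s)
import Data.Nat.Properties as ℕ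
open import Algebra.Properties.CommutativeSemigroup ℕ.+-commutativeSemigroup using (interchange)
open import Data.Fin using (Fin; zero; suc; toℕ; inject₁; fromℕ; fromℕ<; punchIn; punchOut)
import Data.Fin.Properties as Fin
open import Data.Bool using (Bool; true; false; if_then_else_)
open import Data.Bool.Properties using () renaming (_≟_ to _≟ᴮ_)
open import Data.List using ([]; _∷_; map; allFin)
open import Data.List.Properties using (map-tabulate)
open import Data.Nat.ListAction using (sum)
open import Data.Product using (Σ; ∃; _×_; _,_; proj₁; proj₂)
open import Data.Sum using (_⊎_; inj₁; inj₂) renaming (map to map⊎)
open import Data.Empty using (⊥; ⊥-elim)
open import Function using (_∘_; id)
open import Relation.Nullary using (¬_; Dec; yes; no)
open import Relation.Nullary.Decidable using (_×-dec_; ¬?; ⌊_⌋)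
open import Relation.Binary.PropositionalEquality
  using (_≡_; _≢_; refl; sym; trans; cong; subst; module ≡-Reasoning)

true≢false : ∀ {b} → b ≡ true → b ≡ false → ⊥
true≢false refl ()

not-true : ∀ {b} → ¬ (b ≡ true) → b ≡ false
not-true {false} _ = refl
not-true {true} b≢true = ⊥-elim (b≢true refl)

ind : Bool → ℕ
ind b = if b then 1 else 0

sum-map-mono : ∀ {A : Set} {f g : A → ℕ} → (∀ x → f x ≤ g x) →
  ∀ xs → sum (map f xs) ≤ sum (map g xs)
sum-map-mono f≤g [] = z≤n
sum-map-mono f≤g (x ∷ xs) = ℕ.+-mono-≤ (f≤g x) (sum-map-mono f≤g xs)

sum-map-+ : ∀ {A : Set} (f g : A → ℕ) xs →
  sum (map (λ x → f x + g x) xs) ≡ sum (map f xs) + sum (map g xs)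
sum-map-+ f g [] = refl
sum-map-+ f g (x ∷ xs) = begin
  (f x + g x) + sum (map (λ y → f y + g y) xs)   ≡⟨ cong (f x + g x +_) (sum-map-+ f g xs) ⟩
  (f x + g x) + (sum (map f xs) + sum (map g xs)) ≡⟨ interchange (f x) (g x) _ _ ⟩
  (f x + sum (map f xs)) + (g x + sum (map g xs)) ∎
  where open ≡-Reasoning

size-suc : ∀ {n} (f : Fin (suc n) → Bool) → size f ≡ ind (f zero) + size (f ∘ suc)
size-suc {n} f = cong (λ xs → ind (f zero) + sum xs)
  (trans (map-tabulate suc g) (sym (map-tabulate id (g ∘ suc))))
  where
    g : Fin (suc n) → ℕ
    g v = ind (f v)

size-empty : ∀ {n} (f : Fin n → Bool) → (∀ v → f v ≡ false) → size f ≡ 0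
size-empty {zero} f _ = refl
size-empty {suc n} f empty rewrite size-suc f | empty zero = size-empty (f ∘ suc) (empty ∘ suc)

size-singleton : ∀ {n} (f : Fin n → Bool) {u} → f u ≡ true →
  (∀ v → f v ≡ true → v ≡ u) → size f ≡ 1
size-singleton {suc n} f {zero} fu only-u rewrite size-suc f | fu =
  cong suc (size-empty (f ∘ suc) (λ v → not-true (λ fv → zero≢suc (only-u (suc v) fv))))
  where
    zero≢suc : ∀ {v : Fin n} → suc v ≢ zero
    zero≢suc ()
size-singleton {suc n} f {suc u} fu only-u rewrite size-suc f with f zero in f0
... | true with only-u zero f0
...   | ()
size-singleton {suc n} f {suc u} fu only-u | false =
  size-singleton (f ∘ suc) fu (λ v fv → Fin.suc-injective (only-u (suc v) fv))

record Enumeration {n} (f : Fin n → Bool) (k : ℕ) : Set where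
  field
    element   : Fin k → Fin n
    injective : ∀ {i j} → element i ≡ element j → i ≡ j
    member    : ∀ i → f (element i) ≡ true

enumerate : ∀ {n} (f : Fin n → Bool) → Enumeration f (size f)
enumerate {zero} f = record { element = λ () ; injective = λ { {()} } ; member = λ () }
enumerate {suc n} f rewrite size-suc f with f zero in f0
... | true = record { element = element′ ; injective = injective′ ; member = member′ }
  where
    open Enumeration (enumerate (f ∘ suc))
    element′ : Fin (suc (size (f ∘ suc))) → Fin (suc n)
    element′ zero = zero
    element′ (suc i) = suc (element i)
    injective′ : ∀ {i j} → element′ i ≡ element′ j → i ≡ j
    injective′ {zero} {zero} _ = refl
    injective′ {suc i} {suc j} e = cong suc (injective (Fin.suc-injective e))
    member′ : ∀ i → f (element′ i) ≡ true
    member′ zero = f0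
    member′ (suc i) = member i
... | false = record { element = suc ∘ element ; injective = injective ∘ Fin.suc-injective ; member = member }
  where open Enumeration (enumerate (f ∘ suc))

mod3 : ℕ → Fin 3
mod3 0 = zero
mod3 1 = suc zero
mod3 2 = suc (suc zero)
mod3 (suc (suc (suc d))) = mod3 d

mod3-suc : ∀ d → mod3 (suc d) ≢ mod3 d
mod3-suc 0 ()
mod3-suc 1 ()
mod3-suc 2 ()
mod3-suc (suc (suc (suc d))) = mod3-suc d

mod3-suc-suc : ∀ d → mod3 (suc (suc d)) ≢ mod3 d
mod3-suc-suc 0 ()
mod3-suc-suc 1 ()
mod3-suc-suc 2 ()
mod3-suc-suc (suc (suc (suc d))) = mod3-suc-suc d

mod3-one-apart : ∀ {a b} → a ≡ suc b → mod3 a ≢ mod3 b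
mod3-one-apart {b = b} refl = mod3-suc b

mod3-two-apart : ∀ {a b} → a ≡ suc (suc b) → mod3 a ≢ mod3 b
mod3-two-apart {b = b} refl = mod3-suc-suc b

module GraphFacts {n : ℕ} (G : Graph n) where

  adj? : ∀ u v → Dec (Adj G u v)
  adj? u v = adj G u v ≟ᴮ true

  adj-irrefl : ∀ {v} → ¬ Adj G v v
  adj-irrefl {v} a = true≢false a (irrefl G v)

  adj-sym : ∀ {u v} → Adj G u v → Adj G v u
  adj-sym {u} {v} a = trans (Graph.sym G v u) a

  adj⇒≢ : ∀ {u v} → Adj G u v → u ≢ v
  adj⇒≢ a refl = adj-irrefl a

  deg-isolated : ∀ {v} → (∀ y → ¬ Adj G v y) → deg G v ≡ 0
  deg-isolated {v} no-neighbour = size-empty (adj G v) (λ y → not-true (no-neighbour y))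

  deg-pendant : ∀ {v u} → Adj G v u → (∀ y → Adj G v y → y ≡ u) → deg G v ≡ 1
  deg-pendant {v} a only-u = size-singleton (adj G v) a only-u

  small-component : ∀ {w u} → ¬ BigComponent G w → Adj G w u →
    ∀ z → Reach G w z → z ≡ w ⊎ z ≡ u
  small-component {w} {u} small a z r with z Fin.≟ w | z Fin.≟ u
  ... | yes z≡w | _ = inj₁ z≡w
  ... | no _ | yes z≡u = inj₂ z≡u
  ... | no z≢w | no z≢u =
    ⊥-elim (small (w , u , z , here , step a here , r , adj⇒≢ a , z≢w ∘ sym , z≢u ∘ sym))

  TwoNeighbours : Fin n → Set
  TwoNeighbours v = ∃ λ y → ∃ λ z → Adj G v y × Adj G v z × y ≢ z

  twoNeighbours? : ∀ v → Dec (TwoNeighbours v)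
  twoNeighbours? v = Fin.any? (λ y → Fin.any? (λ z → adj? v y ×-dec adj? v z ×-dec ¬? (y Fin.≟ z)))

  data LowDegree (v : Fin n) : Set where
    zero-neighbours : (∀ y → ¬ Adj G v y) → LowDegree v
    one-neighbour   : ∀ u → Adj G v u → (∀ y → Adj G v y → y ≡ u) → LowDegree v

  -- If every vertex has two distinct neighbours, the walk that always leaves
  -- a vertex by an edge other than the one it arrived by must revisit a vertex
  -- (pigeonhole); its first revisit closes a cycle of length at least 3.
  module NonBacktrackingWalk (two : ∀ v → TwoNeighbours v) (start : Fin n) where

    next : Fin n → Fin n → Fin n
    next p c with two c
    ... | y , z , _ with y Fin.≟ p
    ...   | yes _ = z
    ...   | no _ = y

    next-adj : ∀ p c → Adj G c (next p c)
    next-adj p c with two c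
    ... | y , z , cy , cz , _ with y Fin.≟ p
    ...   | yes _ = cz
    ...   | no _ = cy

    next-≢ : ∀ p c → next p c ≢ p
    next-≢ p c with two c
    ... | y , z , _ , _ , y≢z with y Fin.≟ p
    ...   | yes y≡p = λ z≡p → y≢z (trans y≡p (sym z≡p))
    ...   | no y≢p = y≢p

    walk : ℕ → Fin n
    walk 0 = start
    walk 1 = next start start
    walk (suc (suc k)) = next (walk k) (walk (suc k))

    walk-adj : ∀ k → Adj G (walk k) (walk (suc k))
    walk-adj zero = next-adj start start
    walk-adj (suc k) = next-adj (walk k) (walk (suc k))

    walk-no-backtrack : ∀ k → walk (suc (suc k)) ≢ walk k
    walk-no-backtrack k = next-≢ (walk k) (walk (suc k))

    Distinct : ℕ → Set
    Distinct k = ∀ {a b} → a < k → b < k → walk a ≡ walk b → a ≡ b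

    -- A first revisit walk (a + 1 + o) ≡ walk a closes a cycle on
    -- walk a, …, walk (a + o); o ≥ 2 since edges are loopless and the walk
    -- does not backtrack.
    revisit⇒cycle : ∀ a o → Distinct (a + suc o) → walk (a + suc o) ≡ walk a → Cycle G
    revisit⇒cycle a zero _ revisit =
      ⊥-elim (adj⇒≢ (walk-adj a) (sym (trans (cong walk (ℕ.+-comm 1 a)) revisit)))
    revisit⇒cycle a (suc zero) _ revisit =
      ⊥-elim (walk-no-backtrack a (trans (cong walk (ℕ.+-comm 2 a)) revisit))
    revisit⇒cycle a (suc (suc m)) distinct revisit = record
      { m = m
      ; c = λ j → walk (a + toℕ j)
      ; inj = λ {i} {j} e → Fin.toℕ-injective (ℕ.+-cancelˡ-≡ a _ _
          (distinct (ℕ.+-monoʳ-< a (Fin.toℕ<n i)) (ℕ.+-monoʳ-< a (Fin.toℕ<n j)) e))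
      ; edges = edges
      ; close = close
      }
      where
        edges : ∀ (i : Fin (suc (suc m))) → Adj G (walk (a + toℕ (inject₁ i))) (walk (a + toℕ (suc i)))
        edges i rewrite Fin.toℕ-inject₁ i | ℕ.+-suc a (toℕ i) = walk-adj (a + toℕ i)
        close : Adj G (walk (a + toℕ (fromℕ (suc (suc m))))) (walk (a + 0))
        close rewrite Fin.toℕ-fromℕ (suc (suc m)) | ℕ.+-identityʳ a =
          subst (Adj G (walk (a + suc (suc m))))
                (trans (cong walk (sym (ℕ.+-suc a (suc (suc m))))) revisit)
                (walk-adj (a + suc (suc m)))

    distinct-or-cycle : ∀ k → Distinct k ⊎ Cycle G
    distinct-or-cycle zero = inj₁ (λ ())
    distinct-or-cycle (suc k) with distinct-or-cycle k
    ... | inj₂ cycle = inj₂ cycle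
    ... | inj₁ distinct with Fin.any? (λ (i : Fin k) → walk k Fin.≟ walk (toℕ i))
    ... | yes (i , revisit) =
      let (o , i+o≡k) = ℕ.m≤n⇒∃[o]m+o≡n (Fin.toℕ<n i)
          k≡i+1+o = sym (trans (ℕ.+-suc (toℕ i) o) i+o≡k)
      in inj₂ (revisit⇒cycle (toℕ i) o (subst Distinct k≡i+1+o distinct)
                            (subst (λ j → walk j ≡ walk (toℕ i)) k≡i+1+o revisit))
    ... | no no-revisit = inj₁ extended
      where
        new : ∀ {a} → a < k → walk k ≢ walk a
        new {a} a<k e = no-revisit (fromℕ< a<k , trans e (cong walk (sym (Fin.toℕ-fromℕ< a<k))))
        extended : Distinct (suc k)
        extended {a} {b} a<1+k b<1+k e
          with ℕ.m<1+n⇒m<n∨m≡n a<1+k | ℕ.m<1+n⇒m<n∨m≡n b<1+k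
        ... | inj₁ a<k | inj₁ b<k = distinct a<k b<k e
        ... | inj₂ refl | inj₂ refl = refl
        ... | inj₂ refl | inj₁ b<k = ⊥-elim (new b<k e)
        ... | inj₁ a<k | inj₂ refl = ⊥-elim (new a<k (sym e))

    walk-cycle : Cycle G
    walk-cycle with distinct-or-cycle (suc n)
    ... | inj₂ cycle = cycle
    ... | inj₁ distinct with Fin.pigeonhole (ℕ.n<1+n n) (λ (i : Fin (suc n)) → walk (toℕ i))
    ... | i , j , i<j , e = ⊥-elim (ℕ.<-irrefl (distinct (Fin.toℕ<n i) (Fin.toℕ<n j) e) i<j)

  low-degree-vertex : IsForest G → Fin n → ∃ LowDegree
  low-degree-vertex forest start with Fin.all? twoNeighbours?
  ... | yes two = ⊥-elim (forest (NonBacktrackingWalk.walk-cycle two start))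
  ... | no ¬two with Fin.¬∀⟶∃¬ _ TwoNeighbours twoNeighbours? ¬two
  ... | x , ¬two-x with Fin.any? (adj? x)
  ... | no no-neighbour = x , zero-neighbours (λ y a → no-neighbour (y , a))
  ... | yes (u , a) = x , one-neighbour u a only-u
    where
      only-u : ∀ y → Adj G x y → y ≡ u
      only-u y b with y Fin.≟ u
      ... | yes y≡u = y≡u
      ... | no y≢u = ⊥-elim (¬two-x (y , u , b , a , y≢u))

delete : ∀ {m} → Graph (suc m) → Fin (suc m) → Graph m
delete G x = record
  { adj = λ u v → adj G (punchIn x u) (punchIn x v)
  ; sym = λ u v → Graph.sym G (punchIn x u) (punchIn x v)
  ; irrefl = λ v → irrefl G (punchIn x v)
  }

delete-forest : ∀ {m} (G : Graph (suc m)) x → IsForest G → IsForest (delete G x)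
delete-forest G x forest cycle = forest record
  { m = Cycle.m cycle
  ; c = punchIn x ∘ Cycle.c cycle
  ; inj = λ e → Cycle.inj cycle (Fin.punchIn-injective x _ _ e)
  ; edges = Cycle.edges cycle
  ; close = Cycle.close cycle
  }

Parent : ∀ {n} → Graph n → (Fin n → ℕ) → Fin n → Fin n → Set
Parent G depth x y = Adj G x y × depth x ≡ suc (depth y)

record Rooting {n} (G : Graph n) : Set where
  field
    depth           : Fin n → ℕ
    adjacent-depths : ∀ {x y} → Adj G x y → Parent G depth x y ⊎ Parent G depth y x
    unique-parent   : ∀ {x y z} → Parent G depth x y → Parent G depth x z → y ≡ z

rooting-∅ : (G : Graph 0) → Rooting G
rooting-∅ G .Rooting.depth ()
rooting-∅ G .Rooting.adjacent-depths {()}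
rooting-∅ G .Rooting.unique-parent {()}

-- A rooting of G with a vertex x of degree ≤ 1 deleted extends to G: x is
-- placed one level below its neighbour, if any.
module ExtendRooting {m : ℕ} (G : Graph (suc m)) (x : Fin (suc m))
    (low : GraphFacts.LowDegree G x) (R : Rooting (delete G x)) where
  open GraphFacts G
  open Rooting R renaming (depth to depth′; adjacent-depths to adjacent-depths′; unique-parent to unique-parent′)

  data View : Fin (suc m) → Set where
    deleted : View x
    kept    : ∀ u → View (punchIn x u)

  view : ∀ y → View y
  view y with x Fin.≟ y
  ... | yes refl = deleted
  ... | no x≢y = subst View (Fin.punchIn-punchOut x≢y) (kept (punchOut x≢y))

  depth-of-x : LowDegree x → ℕ
  depth-of-x (zero-neighbours _) = 0
  depth-of-x (one-neighbour u a _) = suc (depth′ (punchOut (adj⇒≢ a)))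

  depth : Fin (suc m) → ℕ
  depth y with x Fin.≟ y
  ... | yes _ = depth-of-x low
  ... | no x≢y = depth′ (punchOut x≢y)

  depth-x : depth x ≡ depth-of-x low
  depth-x with x Fin.≟ x
  ... | yes _ = refl
  ... | no x≢x = ⊥-elim (x≢x refl)

  depth-kept : ∀ u → depth (punchIn x u) ≡ depth′ u
  depth-kept u with x Fin.≟ punchIn x u
  ... | yes x≡u = ⊥-elim (Fin.punchInᵢ≢i x u (sym x≡u))
  ... | no _ = cong depth′ (trans (Fin.punchOut-cong x refl) (Fin.punchOut-punchIn x))

  x-neighbour-unique : ∀ {y z} → LowDegree x → Adj G x y → Adj G x z → y ≡ z
  x-neighbour-unique (zero-neighbours none) a _ = ⊥-elim (none _ a)
  x-neighbour-unique (one-neighbour u _ only-u) a b = trans (only-u _ a) (sym (only-u _ b))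

  x-neighbour-depth : ∀ {y} (l : LowDegree x) → Adj G x y → depth-of-x l ≡ suc (depth y)
  x-neighbour-depth (zero-neighbours none) a = ⊥-elim (none _ a)
  x-neighbour-depth (one-neighbour u au only-u) a rewrite only-u _ a = cong suc (sym (trans
    (cong depth (sym (Fin.punchIn-punchOut (adj⇒≢ au)))) (depth-kept _)))

  x-parent : ∀ {y} → Adj G x y → Parent G depth x y
  x-parent a = a , trans depth-x (x-neighbour-depth low a)

  x-childless : ∀ {y} → ¬ Parent G depth y x
  x-childless {y} (a , y-below-x) =
    ℕ.m≢1+n+m (depth y) {1} (trans y-below-x (cong suc (proj₂ (x-parent (adj-sym a)))))

  lift : ∀ {u v} → Parent (delete G x) depth′ u v → Parent G depth (punchIn x u) (punchIn x v)
  lift {u} {v} (a , d) = a , trans (depth-kept u) (trans d (cong suc (sym (depth-kept v))))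

  lower : ∀ {u v} → Parent G depth (punchIn x u) (punchIn x v) → Parent (delete G x) depth′ u v
  lower {u} {v} (a , d) = a , trans (sym (depth-kept u)) (trans d (cong suc (depth-kept v)))

  adjacent-depths : ∀ {y z} → Adj G y z → Parent G depth y z ⊎ Parent G depth z y
  adjacent-depths {y} {z} a with view y | view z
  ... | deleted | deleted = ⊥-elim (adj-irrefl a)
  ... | deleted | kept _ = inj₁ (x-parent a)
  ... | kept _ | deleted = inj₂ (x-parent (adj-sym a))
  ... | kept _ | kept _ = map⊎ lift lift (adjacent-depths′ a)

  unique-parent : ∀ {y z₁ z₂} → Parent G depth y z₁ → Parent G depth y z₂ → z₁ ≡ z₂
  unique-parent {y} {z₁} {z₂} p q with view y | view z₁ | view z₂
  ... | deleted | _ | _ = x-neighbour-unique low (proj₁ p) (proj₁ q)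
  unique-parent p q | kept _ | deleted | _ = ⊥-elim (x-childless p)
  unique-parent p q | kept _ | kept _ | deleted = ⊥-elim (x-childless q)
  unique-parent p q | kept _ | kept _ | kept _ = cong (punchIn x) (unique-parent′ (lower p) (lower q))

  rooting : Rooting G
  rooting = record { depth = depth ; adjacent-depths = adjacent-depths ; unique-parent = unique-parent }

forest-rooting : ∀ {n} (G : Graph n) → IsForest G → Rooting G
forest-rooting {zero} G _ = rooting-∅ G
forest-rooting {suc m} G forest with GraphFacts.low-degree-vertex G forest zero
... | x , low = ExtendRooting.rooting G x low (forest-rooting (delete G x) (delete-forest G x forest))

module RootingFacts {n : ℕ} {G : Graph n} (R : Rooting G) where
  open GraphFacts G
  open Rooting R

  Separated : Fin n → Fin n → Fin n → Fin n → Set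
  Separated t₁ b₁ t₂ b₂ =
    (t₁ ≢ t₂ × t₁ ≢ b₂ × b₁ ≢ t₂ × b₁ ≢ b₂) ×
    (¬ Adj G t₁ t₂ × ¬ Adj G t₁ b₂ × ¬ Adj G b₁ t₂ × ¬ Adj G b₁ b₂)

  -- Parent edges with distinct tops whose depths are congruent mod 3 are
  -- separated: any coincidence or edge between them would relate depths
  -- differing by 1 or 2, or give a vertex two parents.
  separated : ∀ {t₁ b₁ t₂ b₂} → Parent G depth b₁ t₁ → Parent G depth b₂ t₂ → t₁ ≢ t₂ →
    mod3 (depth t₁) ≡ mod3 (depth t₂) → Separated t₁ b₁ t₂ b₂
  separated {t₁} {b₁} {t₂} {b₂} p₁@(_ , d₁) p₂@(_ , d₂) t₁≢t₂ same =
    (t₁≢t₂ , t₁≢b₂ , b₁≢t₂ , b₁≢b₂) , (t₁≁t₂ , t₁≁b₂ , b₁≁t₂ , b₁≁b₂)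
    where
      t₁≢b₂ : t₁ ≢ b₂
      t₁≢b₂ refl = mod3-one-apart d₂ same
      b₁≢t₂ : b₁ ≢ t₂
      b₁≢t₂ refl = mod3-one-apart d₁ (sym same)
      b₁≢b₂ : b₁ ≢ b₂
      b₁≢b₂ refl = t₁≢t₂ (unique-parent p₁ p₂)

      t₁≁t₂ : ¬ Adj G t₁ t₂
      t₁≁t₂ a with adjacent-depths a
      ... | inj₁ (_ , d) = mod3-one-apart d same
      ... | inj₂ (_ , d) = mod3-one-apart d (sym same)
      t₁≁b₂ : ¬ Adj G t₁ b₂
      t₁≁b₂ a with adjacent-depths a
      ... | inj₁ (_ , d) = mod3-two-apart (trans d (cong suc d₂)) same
      ... | inj₂ p = t₁≢t₂ (unique-parent p p₂)
      b₁≁t₂ : ¬ Adj G b₁ t₂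
      b₁≁t₂ a with adjacent-depths a
      ... | inj₁ p = t₁≢t₂ (unique-parent p₁ p)
      ... | inj₂ (_ , d) = mod3-two-apart (trans d (cong suc d₁)) (sym same)
      b₁≁b₂ : ¬ Adj G b₁ b₂
      b₁≁b₂ a with adjacent-depths a
      ... | inj₁ (_ , d) = mod3-one-apart (ℕ.suc-injective (trans (sym d₁) (trans d (cong suc d₂)))) same
      ... | inj₂ (_ , d) = mod3-one-apart (ℕ.suc-injective (trans (sym d₂) (trans d (cong suc d₁)))) (sym same)

module Charging {n : ℕ} (G : Graph n) (R : Rooting G) (S : Fin n → Bool) (RF : IsReducedForest G S) where
  open GraphFacts G
  open Rooting R
  open RootingFacts R
  open IsReducedForest RF

  record Charge (v : Fin n) : Set where
    field
      top bottom : Fin n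
      parent     : Parent G depth bottom top
      charged    : top ≡ v ⊎
        (bottom ≡ v × S top ≡ false × (∀ z → Reach G v z → z ≡ v ⊎ z ≡ top))

  -- A vertex of S without children has a parent u and no other neighbour,
  -- so it is a leaf; its component is then {v, u} with u left out of S.
  childless-charge : ∀ v → S v ≡ true → (∀ c → ¬ Parent G depth c v) → Charge v
  childless-charge v v∈S childless with Fin.any? (adj? v)
  ... | no no-neighbour =
    ⊥-elim (true≢false v∈S (isolated v (deg-isolated (λ y a → no-neighbour (y , a)))))
  ... | yes (u , a) = record
    { top = u ; bottom = v ; parent = neighbour-parent a
    ; charged = inj₂ (refl , u∉S , component) }
    where
      neighbour-parent : ∀ {y} → Adj G v y → Parent G depth v y
      neighbour-parent b with adjacent-depths b
      ... | inj₁ p = p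
      ... | inj₂ p = ⊥-elim (childless _ p)
      only-u : ∀ y → Adj G v y → y ≡ u
      only-u y b = unique-parent (neighbour-parent b) (neighbour-parent a)
      not-big : ¬ BigComponent G v
      not-big big = true≢false v∈S (big-leaf v big (deg-pendant a only-u))
      component : ∀ z → Reach G v z → z ≡ v ⊎ z ≡ u
      component = small-component not-big a
      u∉S : S u ≡ false
      u∉S = not-true (λ u∈S → two v u (adj⇒≢ a ∘ sym , step a here , component) (trans v∈S (sym u∈S)))

  charge : ∀ v → S v ≡ true → Charge v
  charge v v∈S with Fin.any? (λ c → adj? c v ×-dec (depth c ℕ.≟ suc (depth v)))
  ... | yes (c , c-child) = record { top = v ; bottom = c ; parent = c-child ; charged = inj₁ refl }
  ... | no childless = childless-charge v v∈S (λ c p → childless (c , p))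

  top-injective : ∀ {v w} → S v ≡ true → S w ≡ true → (P : Charge v) (Q : Charge w) →
    Charge.top P ≡ Charge.top Q → v ≡ w
  top-injective {v} {w} v∈S w∈S P Q same-top with Charge.charged P | Charge.charged Q
  ... | inj₁ tv | inj₁ tw = trans (sym tv) (trans same-top tw)
  ... | inj₁ refl | inj₂ (_ , top∉S , _) = ⊥-elim (true≢false v∈S (trans (cong S same-top) top∉S))
  ... | inj₂ (_ , top∉S , _) | inj₁ refl = ⊥-elim (true≢false w∈S (trans (cong S (sym same-top)) top∉S))
  top-injective {v} {w} v∈S w∈S P Q same-top | inj₂ (refl , _) | inj₂ (refl , _ , component-w)
    with component-w v (step w→t (step (adj-sym v→t) here))
    where
      w→t : Adj G w (Charge.top Q)
      w→t = proj₁ (Charge.parent Q)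
      v→t : Adj G v (Charge.top Q)
      v→t = subst (Adj G v) same-top (proj₁ (Charge.parent P))
  ... | inj₁ v≡w = v≡w
  ... | inj₂ v≡t = ⊥-elim (adj⇒≢ (proj₁ (Charge.parent P)) (trans v≡t (sym same-top)))

  residue : ∀ v → S v ≡ true → Fin 3
  residue v v∈S = mod3 (depth (Charge.top (charge v v∈S)))

  class : Fin 3 → Fin n → Bool
  class j v with S v ≟ᴮ true
  ... | yes v∈S = ⌊ residue v v∈S Fin.≟ j ⌋
  ... | no _ = false

  class-member : ∀ j v → class j v ≡ true → Σ (S v ≡ true) λ v∈S → residue v v∈S ≡ j
  class-member j v e with S v ≟ᴮ true
  ... | yes v∈S with residue v v∈S Fin.≟ j
  ...   | yes r≡j = v∈S , r≡j
  class-member j v () | yes v∈S | no _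
  class-member j v () | no _

  class-cover : ∀ v → ind (S v) ≤ ind (class zero v) + (ind (class (suc zero) v) + ind (class (suc (suc zero)) v))
  class-cover v with S v ≟ᴮ true
  ... | no v∉S = ℕ.≤-trans (ℕ.≤-reflexive (cong ind (not-true v∉S))) z≤n
  ... | yes v∈S = ℕ.≤-trans (ℕ.≤-reflexive (cong ind v∈S)) (some-class (residue v v∈S))
    where
      some-class : ∀ (r : Fin 3) → 1 ≤ ind ⌊ r Fin.≟ zero ⌋ + (ind ⌊ r Fin.≟ suc zero ⌋ + ind ⌊ r Fin.≟ suc (suc zero) ⌋)
      some-class zero = s≤s z≤n
      some-class (suc zero) = s≤s z≤n
      some-class (suc (suc zero)) = s≤s z≤n

  class-matching : ∀ j → InducedMatching G (size (class j))
  class-matching j = record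
    { a = Charge.top ∘ charge-of
    ; b = Charge.bottom ∘ charge-of
    ; edge = λ i → adj-sym (proj₁ (Charge.parent (charge-of i)))
    ; disjoint = λ i i′ i≢i′ → proj₁ (separated-pair i≢i′)
    ; induced = λ i i′ i≢i′ → proj₂ (separated-pair i≢i′)
    }
    where
      open Enumeration (enumerate (class j))
      in-S : ∀ i → S (element i) ≡ true
      in-S i = proj₁ (class-member j (element i) (member i))
      charge-of : ∀ i → Charge (element i)
      charge-of i = charge (element i) (in-S i)
      separated-pair : ∀ {i i′} → i ≢ i′ → Separated (Charge.top (charge-of i)) (Charge.bottom (charge-of i))
                                                   (Charge.top (charge-of i′)) (Charge.bottom (charge-of i′))
      separated-pair {i} {i′} i≢i′ = separated
        (Charge.parent (charge-of i)) (Charge.parent (charge-of i′))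
        (λ same-top → i≢i′ (injective (top-injective (in-S i) (in-S i′) (charge-of i) (charge-of i′) same-top)))
        (trans (proj₂ (class-member j (element i) (member i)))
               (sym (proj₂ (class-member j (element i′) (member i′)))))

  size-bound : ∀ p → MaxIndMatchingAtMost G p → size S ≤ 3 * p
  size-bound p max = begin
    size S                                             ≤⟨ sum-map-mono class-cover (allFin n) ⟩
    sum (map (λ v → ind (c₀ v) + (ind (c₁ v) + ind (c₂ v))) (allFin n))
                                                       ≡⟨ sum-map-+ (ind ∘ c₀) _ (allFin n) ⟩
    size c₀ + sum (map (λ v → ind (c₁ v) + ind (c₂ v)) (allFin n))
                                                       ≡⟨ cong (size c₀ +_) (sum-map-+ (ind ∘ c₁) (ind ∘ c₂) (allFin n)) ⟩
    size c₀ + (size c₁ + size c₂)                      ≤⟨ ℕ.+-mono-≤ (bounded zero) (ℕ.+-mono-≤ (bounded (suc zero)) (bounded (suc (suc zero)))) ⟩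
    p + (p + p)                                        ≡⟨ cong (λ q → p + (p + q)) (sym (ℕ.+-identityʳ p)) ⟩
    3 * p                                              ∎
    where
      open ℕ.≤-Reasoning
      c₀ c₁ c₂ : Fin n → Bool
      c₀ = class zero
      c₁ = class (suc zero)
      c₂ = class (suc (suc zero))
      bounded : ∀ j → size (class j) ≤ p
      bounded j = max _ (class-matching j)

lemma1 : (p : ℕ) → 1 ≤ p → (n : ℕ) → (F : Graph n) → IsForest F →
    MaxIndMatchingAtMost F p →
    (S : Fin n → Bool) → IsReducedForest F S → size S ≤ 6 * p
lemma1 p _ n F forest max S reduced = ℕ.≤-trans
  (Charging.size-bound F (forest-rooting F forest) S reduced p max)
  (ℕ.*-monoˡ-≤ p {3} {6} (s≤s (s≤s (s≤s z≤n))))
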